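{- For all integers $l,d,n\ge0$ there is a closed $\forall\exists$-sentence $\mathrm{FC}^n_{l,d}$ in the language $\{\mathbf 0,\mathbf 1,\vee,\wedge,\to\}$ such that for every Heyting algebra $A$: $h_{l,d}(A)\le n$ if and only if $A\models\mathrm{FC}^n_{l,d}$. In particular, every Heyting algebra elementarily equivalent to $A$ has the same $(l,d)$-index as $A$.
   Context: IPC formulas in $\bar p=(p_1,\dots,p_l)$ are identified with Heyting algebra terms; degree = maximal nesting of $\to$. For $\bar a\in A^l$, $\mathrm{Th}_n(\bar a)=\{\varphi(\bar p):\deg\varphi\le n,\ \varphi(\bar a)=\mathbf 1\}$ and $\bar a\approx_n\bar a'$ iff $\mathrm{Th}_n(\bar a)=\mathrm{Th}_n(\bar a')$. A system of degree $\le d$ in $(\bar p,q)$ is $t(\bar p,q)=\mathbf 1\wedge\bigwedge_{k\le\kappa}s_k(\bar p,q)\ne\mathbf 1$ with $t,s_k$ of degree $\le d$. The $(l,d)$-index $h_{l,d}(A)$ is the least $n$ such that for all $\bar a,\bar a'\in A^l$ with $\bar a\approx_n\bar a'$ and every system $S(\bar p,q)$ of degree $\le d$, $S(\bar a,q)$ has a solution in $A$ iff $S(\bar a',q)$ does; $h_{l,d}(A)=+\infty$ if there is no such $n$. -}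

module Defs where

open import Level using (Level; _⊔_; Lift; lift; Setω)
open import Data.Nat using (ℕ; zero; suc; _≤_) renaming (_⊔_ to _⊔ℕ_)
open import Data.Fin using (Fin)
open import Data.Product using (Σ; ∃; _×_; _,_)
open import Data.Sum using (_⊎_)
import Data.Empty
import Data.Unit
open import Data.Vec.Functional using (Vector; _∷_)
open import Relation.Nullary using (¬_)
open import Function.Bundles using (_⇔_)
open import Relation.Binary.Lattice.Bundles using (HeytingAlgebra)

data Fm (l : ℕ) : Set where
  var  : Fin l → Fm l
  𝟎 𝟏  : Fm l
  _∧′_ _∨′_ _⇒′_ : Fm l → Fm l → Fm l

deg : ∀ {l} → Fm l → ℕ
deg (var _)   = 0
deg 𝟎         = 0
deg 𝟏         = 0
deg (φ ∧′ ψ)  = deg φ ⊔ℕ deg ψ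
deg (φ ∨′ ψ)  = deg φ ⊔ℕ deg ψ
deg (φ ⇒′ ψ)  = suc (deg φ ⊔ℕ deg ψ)

-- A system t(p̄,q) = 1 ∧ ⋀_{k ≤ κ} s_k(p̄,q) ≠ 1 in (p̄,q).
-- The variable q is  var zero , the parameter p_i is  var (suc i).

record System (l : ℕ) : Set where
  field
    t : Fm (suc l)
    κ : ℕ
    s : Fin (suc κ) → Fm (suc l)

SysDeg≤ : ∀ {l} → System l → ℕ → Set
SysDeg≤ S d = (deg (System.t S) ≤ d) × ((k : Fin (suc (System.κ S))) → deg (System.s S k) ≤ d)

module _ {c ℓ₁ ℓ₂} (A : HeytingAlgebra c ℓ₁ ℓ₂) where
  open HeytingAlgebra A hiding (_≤_)

  ⟦_⟧ : ∀ {l} → Fm l → Vector Carrier l → Carrier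
  ⟦ var i ⟧   a = a i
  ⟦ 𝟎 ⟧       a = ⊥
  ⟦ 𝟏 ⟧       a = ⊤
  ⟦ φ ∧′ ψ ⟧  a = ⟦ φ ⟧ a ∧ ⟦ ψ ⟧ a
  ⟦ φ ∨′ ψ ⟧  a = ⟦ φ ⟧ a ∨ ⟦ ψ ⟧ a
  ⟦ φ ⇒′ ψ ⟧  a = ⟦ φ ⟧ a ⇨ ⟦ ψ ⟧ a

  _≈[_]_ : ∀ {l} → Vector Carrier l → ℕ → Vector Carrier l → Set ℓ₁
  _≈[_]_ {l} a n a′ =
    (φ : Fm l) → deg φ ≤ n → ((⟦ φ ⟧ a ≈ ⊤) ⇔ (⟦ φ ⟧ a′ ≈ ⊤))

  SolutionOf : ∀ {l} → System l → Vector Carrier l → Carrier → Set ℓ₁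
  SolutionOf S a q =
    (⟦ System.t S ⟧ (q ∷ a) ≈ ⊤) ×
    ((k : Fin (suc (System.κ S))) → ¬ (⟦ System.s S k ⟧ (q ∷ a) ≈ ⊤))

  Solvable : ∀ {l} → System l → Vector Carrier l → Set (c ⊔ ℓ₁)
  Solvable S a = Σ Carrier (SolutionOf S a)

  IndexProp : ℕ → ℕ → ℕ → Set (c ⊔ ℓ₁)
  IndexProp l d n =
    (a a′ : Vector Carrier l) → a ≈[ n ] a′ →
    (S : System l) → SysDeg≤ S d → (Solvable S a ⇔ Solvable S a′)

  -- h_{l,d}(A) ≤ n  (h is the least n with IndexProp, +∞ if none)
  IndexLe : ℕ → ℕ → ℕ → Set (c ⊔ ℓ₁)
  IndexLe l d n = ∃ λ m → m ≤ n × IndexProp l d m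

-- First-order logic in the language {0, 1, ∨, ∧, →} with equality
-- (de Bruijn variables; k = number of free variables)

data Tm (k : ℕ) : Set where
  v    : Fin k → Tm k
  𝟎 𝟏  : Tm k
  _∧ₜ_ _∨ₜ_ _⇒ₜ_ : Tm k → Tm k → Tm k

data FO (k : ℕ) : Set where
  _≐_  : Tm k → Tm k → FO k
  ⊥ᶠ ⊤ᶠ : FO k
  _∧ᶠ_ _∨ᶠ_ _⇒ᶠ_ : FO k → FO k → FO k
  ∀ᶠ ∃ᶠ : FO (suc k) → FO k

Sentence : Set
Sentence = FO 0

data QuantifierFree {k} : FO k → Set where
  eq  : ∀ {s t} → QuantifierFree (s ≐ t)
  bot : QuantifierFree ⊥ᶠ
  top : QuantifierFree ⊤ᶠ
  and : ∀ {φ ψ} → QuantifierFree φ → QuantifierFree ψ → QuantifierFree (φ ∧ᶠ ψ)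
  or  : ∀ {φ ψ} → QuantifierFree φ → QuantifierFree ψ → QuantifierFree (φ ∨ᶠ ψ)
  imp : ∀ {φ ψ} → QuantifierFree φ → QuantifierFree ψ → QuantifierFree (φ ⇒ᶠ ψ)

data Existential {k} : FO k → Set where
  qf : ∀ {φ} → QuantifierFree φ → Existential φ
  ex : ∀ {φ} → Existential φ → Existential (∃ᶠ φ)

data ForallExists {k} : FO k → Set where
  e  : ∀ {φ} → Existential φ → ForallExists φ
  al : ∀ {φ} → ForallExists φ → ForallExists (∀ᶠ φ)

module _ {c ℓ₁ ℓ₂} (A : HeytingAlgebra c ℓ₁ ℓ₂) where
  open HeytingAlgebra A hiding (_≤_)

  evalTm : ∀ {k} → Tm k → Vector Carrier k → Carrier
  evalTm (v i)     ρ = ρ i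
  evalTm 𝟎         ρ = ⊥
  evalTm 𝟏         ρ = ⊤
  evalTm (s ∧ₜ t)  ρ = evalTm s ρ ∧ evalTm t ρ
  evalTm (s ∨ₜ t)  ρ = evalTm s ρ ∨ evalTm t ρ
  evalTm (s ⇒ₜ t)  ρ = evalTm s ρ ⇨ evalTm t ρ

  Sat : ∀ {k} → FO k → Vector Carrier k → Set (c ⊔ ℓ₁)
  Sat (s ≐ t)   ρ = Lift c (evalTm s ρ ≈ evalTm t ρ)
  Sat ⊥ᶠ        ρ = Lift (c ⊔ ℓ₁) Data.Empty.⊥
  Sat ⊤ᶠ        ρ = Lift (c ⊔ ℓ₁) Data.Unit.⊤
  Sat (φ ∧ᶠ ψ)  ρ = Sat φ ρ × Sat ψ ρ
  Sat (φ ∨ᶠ ψ)  ρ = Sat φ ρ ⊎ Sat ψ ρ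
  Sat (φ ⇒ᶠ ψ)  ρ = Sat φ ρ → Sat ψ ρ
  Sat (∀ᶠ φ)    ρ = (x : Carrier) → Sat φ (x ∷ ρ)
  Sat (∃ᶠ φ)    ρ = Σ Carrier λ x → Sat φ (x ∷ ρ)

  _⊨_ : Sentence → Set (c ⊔ ℓ₁)
  _⊨_ σ = Sat σ (λ ())

record ∃Sentenceω (P : Sentence → Set) (Q : Sentence → Setω) : Setω where
  constructor _,_,_
  field
    sentence : Sentence
    prop₁    : P sentence
    prop₂    : Q sentence

record _×ω_ (P Q : Setω) : Setω where
  constructor _,_
  field
    fst : P
    snd : Q

-- Up to equivalence in all Heyting algebras there are only finitely many formulas of degree ≤ n
-- in l variables: they are the ∧,∨-combinations of finitely many generators (the variables at
-- level 0, the implications between the finitely many classes of the previous level above it), and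
-- every such combination has a normal form g ∧ x ∨ y, a decision tree over the generators. So
-- ā ≈ₙ ā′ says that ā and ā′ agree on a fixed finite basis, and normalising t and the set of the
-- s_k turns every system of degree ≤ d into one of finitely many normal systems with the same
-- solutions. As the index property is monotone in n, h_{l,d}(A) ≤ n says: whenever ā and ā′ agree
-- on the basis, each normal system solvable at ā is solvable at ā′. With excluded middle the
-- witnesses at ā′ can be chosen in advance, which makes this a ∀∃-sentence; elementarily
-- equivalent algebras satisfy the same sentences, hence have the same (l,d)-index.

module Submission where

open import Axiom.ExcludedMiddle using (ExcludedMiddle)
open import Data.Bool using (Bool; true; false; if_then_else_) renaming (_∧_ to _∧ᵇ_; _∨_ to _∨ᵇ_)
open import Data.Empty using (⊥-elim)
open import Data.Fin using (Fin; zero; suc; combine; remQuot; _↑ˡ_; _↑ʳ_; finToFun; funToFin)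
open import Data.Fin.Properties using (_≟_; any?; remQuot-combine; finToFun-funToFin)
open import Data.Nat using (ℕ; zero; suc; _≤_; _+_; _*_; _^_; z≤n; s≤s)
open import Data.Nat.Properties using (≤-refl; ≤-trans; ⊔-lub; m⊔n≤o⇒m≤o; m⊔n≤o⇒n≤o)
import Data.Product as Product
open import Data.Product using (∃; _×_; _,_; proj₁; proj₂)
open import Data.Vec.Functional using (Vector; _∷_; head; tail)
open import Defs hiding (_,_,_)
open import Function using (_∘_; _⇔_; mk⇔; Equivalence)
import Function.Properties.Equivalence as ⇔
open import Level using (_⊔_; lift; lower)
open import Relation.Binary.Lattice.Bundles using (DistributiveLattice; HeytingAlgebra)
open import Relation.Binary.PropositionalEquality using (_≡_; refl; sym; trans; cong; cong₂; subst)
open import Relation.Nullary using (Dec; yes; no)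

module NodeIdentities {c ℓ₁ ℓ₂} (L : DistributiveLattice c ℓ₁ ℓ₂) where
  open DistributiveLattice L renaming (_≤_ to _⊑_; refl to ⊑-refl; trans to ⊑-trans)
  open import Relation.Binary.Lattice.Properties.DistributiveLattice L using (∧-distribʳ-∨; ∨-distribˡ-∧)
  open import Relation.Binary.Lattice.Properties.MeetSemilattice meetSemilattice using (∧-monotonic; ∧-cong)
  open import Relation.Binary.Lattice.Properties.JoinSemilattice joinSemilattice using (∨-monotonic)
  open import Relation.Binary.Reasoning.PartialOrder poset

  x∧[y∨z]⊑x∧y∨z : ∀ x y z → x ∧ (y ∨ z) ⊑ x ∧ y ∨ z
  x∧[y∨z]⊑x∧y∨z x y z = begin
    x ∧ (y ∨ z)      ≈⟨ ∧-distribˡ-∨ x y z ⟩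
    x ∧ y ∨ x ∧ z    ≤⟨ ∨-monotonic ⊑-refl (x∧y≤y x z) ⟩
    x ∧ y ∨ z        ∎

  ∨-node : ∀ g x₁ y₁ x₂ y₂ → (g ∧ x₁ ∨ y₁) ∨ (g ∧ x₂ ∨ y₂) ≈ g ∧ (x₁ ∨ x₂) ∨ (y₁ ∨ y₂)
  ∨-node g x₁ y₁ x₂ y₂ = antisym
    (∨-least (∨-monotonic (∧-monotonic ⊑-refl (x≤x∨y x₁ x₂)) (x≤x∨y y₁ y₂))
             (∨-monotonic (∧-monotonic ⊑-refl (y≤x∨y x₁ x₂)) (y≤x∨y y₁ y₂)))
    (∨-least (begin
               g ∧ (x₁ ∨ x₂)      ≈⟨ ∧-distribˡ-∨ g x₁ x₂ ⟩
               g ∧ x₁ ∨ g ∧ x₂    ≤⟨ ∨-monotonic (x≤x∨y _ y₁) (x≤x∨y _ y₂) ⟩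
               (g ∧ x₁ ∨ y₁) ∨ (g ∧ x₂ ∨ y₂) ∎)
             (∨-monotonic (y≤x∨y _ y₁) (y≤x∨y _ y₂)))

  ∧-node : ∀ g x₁ y₁ x₂ y₂ →
           (g ∧ x₁ ∨ y₁) ∧ (g ∧ x₂ ∨ y₂) ≈ g ∧ ((x₁ ∨ y₁) ∧ (x₂ ∨ y₂)) ∨ y₁ ∧ y₂
  ∧-node g x₁ y₁ x₂ y₂ = antisym
    (begin
      (g ∧ x₁ ∨ y₁) ∧ (g ∧ x₂ ∨ y₂)
        ≤⟨ ∧-greatest (∧-monotonic (∨-monotonic (x∧y≤x g x₁) ⊑-refl) (∨-monotonic (x∧y≤x g x₂) ⊑-refl))
                      (∧-monotonic (∨-monotonic (x∧y≤y g x₁) ⊑-refl) (∨-monotonic (x∧y≤y g x₂) ⊑-refl)) ⟩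
      ((g ∨ y₁) ∧ (g ∨ y₂)) ∧ X        ≈⟨ ∧-cong (Eq.sym (∨-distribˡ-∧ g y₁ y₂)) Eq.refl ⟩
      (g ∨ y₁ ∧ y₂) ∧ X                ≈⟨ ∧-distribʳ-∨ X g (y₁ ∧ y₂) ⟩
      g ∧ X ∨ (y₁ ∧ y₂) ∧ X            ≤⟨ ∨-monotonic ⊑-refl (x∧y≤x _ X) ⟩
      g ∧ X ∨ y₁ ∧ y₂                  ∎)
    (∨-least (∧-greatest (⊑-trans (∧-monotonic ⊑-refl (x∧y≤x _ _)) (x∧[y∨z]⊑x∧y∨z g x₁ y₁))
                         (⊑-trans (∧-monotonic ⊑-refl (x∧y≤y _ _)) (x∧[y∨z]⊑x∧y∨z g x₂ y₂)))
             (∧-monotonic (y≤x∨y _ y₁) (y≤x∨y _ y₂)))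
    where X = (x₁ ∨ y₁) ∧ (x₂ ∨ y₂)

NormalForm : ℕ → Set
NormalForm zero    = Bool
NormalForm (suc m) = NormalForm m × NormalForm m

toFm : ∀ {l m} → Vector (Fm l) m → NormalForm m → Fm l
toFm {m = zero}  gs b       = if b then 𝟏 else 𝟎
toFm {m = suc m} gs (x , y) = (head gs ∧′ toFm (tail gs) x) ∨′ toFm (tail gs) y

⊤ⁿ ⊥ⁿ : ∀ {m} → NormalForm m
⊤ⁿ {zero}  = true
⊤ⁿ {suc m} = ⊤ⁿ , ⊤ⁿ
⊥ⁿ {zero}  = false
⊥ⁿ {suc m} = ⊥ⁿ , ⊥ⁿ

infixr 6 _∨ⁿ_
infixr 7 _∧ⁿ_

_∨ⁿ_ _∧ⁿ_ : ∀ {m} → NormalForm m → NormalForm m → NormalForm m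
_∨ⁿ_ {zero}  b₁        b₂        = b₁ ∨ᵇ b₂
_∨ⁿ_ {suc m} (x₁ , y₁) (x₂ , y₂) = x₁ ∨ⁿ x₂ , y₁ ∨ⁿ y₂
_∧ⁿ_ {zero}  b₁        b₂        = b₁ ∧ᵇ b₂
_∧ⁿ_ {suc m} (x₁ , y₁) (x₂ , y₂) = (x₁ ∨ⁿ y₁) ∧ⁿ (x₂ ∨ⁿ y₂) , y₁ ∧ⁿ y₂

generatorⁿ : ∀ {m} → Fin m → NormalForm m
generatorⁿ zero    = ⊤ⁿ , ⊥ⁿ
generatorⁿ (suc i) = ⊥ⁿ , generatorⁿ i

toFm-deg : ∀ {l m n} (gs : Vector (Fm l) m) → (∀ i → deg (gs i) ≤ n) → ∀ x → deg (toFm gs x) ≤ n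
toFm-deg {m = zero}  gs gs≤n true    = z≤n
toFm-deg {m = zero}  gs gs≤n false   = z≤n
toFm-deg {m = suc m} gs gs≤n (x , y) =
  ⊔-lub (⊔-lub (gs≤n zero) (toFm-deg (tail gs) (gs≤n ∘ suc) x)) (toFm-deg (tail gs) (gs≤n ∘ suc) y)

nfCount : ℕ → ℕ
nfCount zero    = 2
nfCount (suc m) = nfCount m * nfCount m

decode : ∀ {m} → Fin (nfCount m) → NormalForm m
decode {zero}  zero    = true
decode {zero}  (suc _) = false
decode {suc m} i       = Product.map decode decode (remQuot (nfCount m) i)

encode : ∀ {m} → NormalForm m → Fin (nfCount m)
encode {zero}  true    = zero
encode {zero}  false   = suc zero
encode {suc m} (x , y) = combine (encode x) (encode y)

decode-encode : ∀ {m} (x : NormalForm m) → decode (encode x) ≡ x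
decode-encode {zero}  true    = refl
decode-encode {zero}  false   = refl
decode-encode {suc m} (x , y) =
  trans (cong (Product.map decode decode) (remQuot-combine (encode x) (encode y)))
        (cong₂ _,_ (decode-encode x) (decode-encode y))

module NormalFormSemantics {c ℓ₁ ℓ₂} (A : HeytingAlgebra c ℓ₁ ℓ₂) where
  open HeytingAlgebra A renaming (_≤_ to _⊑_; refl to ⊑-refl; trans to ⊑-trans)
  open import Relation.Binary.Lattice.Properties.HeytingAlgebra A using (distributiveLattice)
  open import Relation.Binary.Lattice.Properties.BoundedLattice boundedLattice
    using (∧-zeroˡ; ∧-zeroʳ; ∨-zeroˡ; ∨-zeroʳ)
  open import Relation.Binary.Lattice.Properties.BoundedJoinSemilattice boundedJoinSemilattice
    using (identityˡ; identityʳ)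
  open import Relation.Binary.Lattice.Properties.MeetSemilattice meetSemilattice using (∧-cong; y≤x⇒x∧y≈y)
  open import Relation.Binary.Lattice.Properties.JoinSemilattice joinSemilattice using (∨-cong)
  open NodeIdentities distributiveLattice using (∨-node; ∧-node)

  private
    ⟦_⟧ᴬ : ∀ {k} → Fm k → Vector Carrier k → Carrier
    ⟦_⟧ᴬ = ⟦_⟧ A

  module _ {l} (ρ : Vector Carrier l) where

    toFm-⊤ⁿ : ∀ {m} (gs : Vector (Fm l) m) → ⟦ toFm gs ⊤ⁿ ⟧ᴬ ρ ≈ ⊤
    toFm-⊤ⁿ {zero}  gs = Eq.refl
    toFm-⊤ⁿ {suc m} gs = Eq.trans (∨-cong Eq.refl (toFm-⊤ⁿ (tail gs))) (∨-zeroʳ _)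

    toFm-⊥ⁿ : ∀ {m} (gs : Vector (Fm l) m) → ⟦ toFm gs ⊥ⁿ ⟧ᴬ ρ ≈ ⊥
    toFm-⊥ⁿ {zero}  gs = Eq.refl
    toFm-⊥ⁿ {suc m} gs = Eq.trans (∨-cong (∧-cong Eq.refl (toFm-⊥ⁿ (tail gs))) (toFm-⊥ⁿ (tail gs)))
                                  (Eq.trans (identityʳ _) (∧-zeroʳ _))

    toFm-generatorⁿ : ∀ {m} (gs : Vector (Fm l) m) i → ⟦ toFm gs (generatorⁿ i) ⟧ᴬ ρ ≈ ⟦ gs i ⟧ᴬ ρ
    toFm-generatorⁿ gs zero = Eq.trans
      (∨-cong (∧-cong Eq.refl (toFm-⊤ⁿ (tail gs))) (toFm-⊥ⁿ (tail gs)))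
      (Eq.trans (identityʳ _) (antisym (x∧y≤x _ _) (∧-greatest ⊑-refl (maximum _))))
    toFm-generatorⁿ gs (suc i) = Eq.trans
      (∨-cong (∧-cong Eq.refl (toFm-⊥ⁿ (tail gs))) (toFm-generatorⁿ (tail gs) i))
      (Eq.trans (∨-cong (∧-zeroʳ _) Eq.refl) (identityˡ _))

    toFm-∨ⁿ : ∀ {m} (gs : Vector (Fm l) m) x y →
              ⟦ toFm gs (x ∨ⁿ y) ⟧ᴬ ρ ≈ ⟦ toFm gs x ⟧ᴬ ρ ∨ ⟦ toFm gs y ⟧ᴬ ρ
    toFm-∨ⁿ {zero}  gs true  y = Eq.sym (∨-zeroˡ _)
    toFm-∨ⁿ {zero}  gs false y = Eq.sym (identityˡ _)
    toFm-∨ⁿ {suc m} gs (x₁ , y₁) (x₂ , y₂) =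
      Eq.trans (∨-cong (∧-cong Eq.refl (toFm-∨ⁿ (tail gs) x₁ x₂)) (toFm-∨ⁿ (tail gs) y₁ y₂))
               (Eq.sym (∨-node _ _ _ _ _))

    toFm-∧ⁿ : ∀ {m} (gs : Vector (Fm l) m) x y →
              ⟦ toFm gs (x ∧ⁿ y) ⟧ᴬ ρ ≈ ⟦ toFm gs x ⟧ᴬ ρ ∧ ⟦ toFm gs y ⟧ᴬ ρ
    toFm-∧ⁿ {zero}  gs true  y = Eq.sym (y≤x⇒x∧y≈y (maximum _))
    toFm-∧ⁿ {zero}  gs false y = Eq.sym (∧-zeroˡ _)
    toFm-∧ⁿ {suc m} gs (x₁ , y₁) (x₂ , y₂) =
      Eq.trans (∨-cong (∧-cong Eq.refl (Eq.trans (toFm-∧ⁿ gs′ (x₁ ∨ⁿ y₁) (x₂ ∨ⁿ y₂))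
                                                 (∧-cong (toFm-∨ⁿ gs′ x₁ y₁) (toFm-∨ⁿ gs′ x₂ y₂))))
                       (toFm-∧ⁿ gs′ y₁ y₂))
               (Eq.sym (∧-node _ _ _ _ _))
      where gs′ = tail gs

genCount : ℕ → ℕ → ℕ
genCount l zero    = l
genCount l (suc n) = nfCount (genCount l n) * nfCount (genCount l n)

basisSize : ℕ → ℕ → ℕ
basisSize l n = nfCount (genCount l n)

generators : ∀ l n → Vector (Fm l) (genCount l n)
basis : ∀ l n → Fin (basisSize l n) → Fm l

generators l zero    = var
generators l (suc n) p = let (i , j) = remQuot (basisSize l n) p in basis l n i ⇒′ basis l n j
basis l n i = toFm (generators l n) (decode i)

generators-deg : ∀ l n i → deg (generators l n i) ≤ n
generators-deg l zero    i = z≤n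
generators-deg l (suc n) p =
  s≤s (⊔-lub (toFm-deg _ (generators-deg l n) _) (toFm-deg _ (generators-deg l n) _))

basis-deg : ∀ l n i → deg (basis l n i) ≤ n
basis-deg l n i = toFm-deg (generators l n) (generators-deg l n) (decode i)

implicationⁿ : ∀ l n →
  NormalForm (genCount l n) → NormalForm (genCount l n) → NormalForm (genCount l (suc n))
implicationⁿ l n x y = generatorⁿ (combine (encode x) (encode y))

generators-implicationⁿ : ∀ l n (x y : NormalForm (genCount l n)) →
  generators l (suc n) (combine (encode x) (encode y)) ≡
  toFm (generators l n) x ⇒′ toFm (generators l n) y
generators-implicationⁿ l n x y =
  trans (cong (λ (i , j) → basis l n i ⇒′ basis l n j) (remQuot-combine (encode x) (encode y)))
        (cong₂ _⇒′_ (cong (toFm _) (decode-encode x)) (cong (toFm _) (decode-encode y)))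

-- The clauses not splitting on n come first, so that they compute for a variable level n.
normalise : ∀ {l} n (φ : Fm l) → deg φ ≤ n → NormalForm (genCount l n)
normalise n 𝟎 _ = ⊥ⁿ
normalise n 𝟏 _ = ⊤ⁿ
normalise n (φ ∧′ ψ) φψ≤n = normalise n φ (m⊔n≤o⇒m≤o _ _ φψ≤n) ∧ⁿ normalise n ψ (m⊔n≤o⇒n≤o _ _ φψ≤n)
normalise n (φ ∨′ ψ) φψ≤n = normalise n φ (m⊔n≤o⇒m≤o _ _ φψ≤n) ∨ⁿ normalise n ψ (m⊔n≤o⇒n≤o _ _ φψ≤n)
normalise zero (var i) _ = generatorⁿ i
-- above level 0 the generators are implications only, so p is represented by ⊤ → p
normalise {l} (suc n) (var i) _ = implicationⁿ l n ⊤ⁿ (normalise n (var i) z≤n)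
normalise zero (φ ⇒′ ψ) ()
normalise {l} (suc n) (φ ⇒′ ψ) (s≤s φψ≤n) =
  implicationⁿ l n (normalise n φ (m⊔n≤o⇒m≤o _ _ φψ≤n)) (normalise n ψ (m⊔n≤o⇒n≤o _ _ φψ≤n))

basisIndex : ∀ {l} n (φ : Fm l) → deg φ ≤ n → Fin (basisSize l n)
basisIndex n φ φ≤n = encode (normalise n φ φ≤n)

module BasisSemantics {c ℓ₁ ℓ₂} (A : HeytingAlgebra c ℓ₁ ℓ₂) where
  open HeytingAlgebra A renaming (_≤_ to _⊑_; refl to ⊑-refl; trans to ⊑-trans)
  open import Relation.Binary.Lattice.Properties.HeytingAlgebra A using (⇨-eval; y≤x⇨y; ⇨-cong)
  open import Relation.Binary.Lattice.Properties.MeetSemilattice meetSemilattice using (∧-cong)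
  open import Relation.Binary.Lattice.Properties.JoinSemilattice joinSemilattice using (∨-cong)
  open NormalFormSemantics A

  private
    ⟦_⟧ᴬ : ∀ {k} → Fm k → Vector Carrier k → Carrier
    ⟦_⟧ᴬ = ⟦_⟧ A

  ⇨-identityˡ : ∀ x → ⊤ ⇨ x ≈ x
  ⇨-identityˡ x = antisym (⊑-trans (∧-greatest ⊑-refl (maximum _)) ⇨-eval) y≤x⇨y

  module _ {l} (ρ : Vector Carrier l) where

    toFm-implicationⁿ : ∀ n (x y : NormalForm (genCount l n)) →
      ⟦ toFm (generators l (suc n)) (implicationⁿ l n x y) ⟧ᴬ ρ ≈
      ⟦ toFm (generators l n) x ⟧ᴬ ρ ⇨ ⟦ toFm (generators l n) y ⟧ᴬ ρ
    toFm-implicationⁿ n x y = Eq.trans (toFm-generatorⁿ ρ (generators l (suc n)) _)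
      (Eq.reflexive (cong (λ φ → ⟦ φ ⟧ᴬ ρ) (generators-implicationⁿ l n x y)))

    normalise-sound : ∀ n (φ : Fm l) (φ≤n : deg φ ≤ n) →
      ⟦ φ ⟧ᴬ ρ ≈ ⟦ toFm (generators l n) (normalise n φ φ≤n) ⟧ᴬ ρ
    normalise-sound n       𝟎        _ = Eq.sym (toFm-⊥ⁿ ρ (generators l n))
    normalise-sound n       𝟏        _ = Eq.sym (toFm-⊤ⁿ ρ (generators l n))
    normalise-sound n       (φ ∧′ ψ) p = Eq.trans
      (∧-cong (normalise-sound n φ (m⊔n≤o⇒m≤o _ _ p)) (normalise-sound n ψ (m⊔n≤o⇒n≤o _ _ p)))
      (Eq.sym (toFm-∧ⁿ ρ (generators l n) _ _))
    normalise-sound n       (φ ∨′ ψ) p = Eq.trans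
      (∨-cong (normalise-sound n φ (m⊔n≤o⇒m≤o _ _ p)) (normalise-sound n ψ (m⊔n≤o⇒n≤o _ _ p)))
      (Eq.sym (toFm-∨ⁿ ρ (generators l n) _ _))
    normalise-sound zero    (var i)  _ = Eq.sym (toFm-generatorⁿ ρ var i)
    normalise-sound (suc n) (var i)  _ = begin
      ρ i
        ≈⟨ Eq.sym (⇨-identityˡ (ρ i)) ⟩
      ⊤ ⇨ ρ i
        ≈⟨ ⇨-cong (Eq.sym (toFm-⊤ⁿ ρ gs)) (normalise-sound n (var i) z≤n) ⟩
      ⟦ toFm gs ⊤ⁿ ⟧ᴬ ρ ⇨ ⟦ toFm gs (normalise n (var i) z≤n) ⟧ᴬ ρ
        ≈⟨ Eq.sym (toFm-implicationⁿ n _ _) ⟩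
      ⟦ toFm (generators l (suc n)) (implicationⁿ l n ⊤ⁿ (normalise n (var i) z≤n)) ⟧ᴬ ρ ∎
      where
        open import Relation.Binary.Reasoning.Setoid setoid
        gs = generators l n
    normalise-sound (suc n) (φ ⇒′ ψ) (s≤s p) = Eq.trans
      (⇨-cong (normalise-sound n φ (m⊔n≤o⇒m≤o _ _ p)) (normalise-sound n ψ (m⊔n≤o⇒n≤o _ _ p)))
      (Eq.sym (toFm-implicationⁿ n _ _))

    basis-sound : ∀ n (φ : Fm l) (φ≤n : deg φ ≤ n) → ⟦ φ ⟧ᴬ ρ ≈ ⟦ basis l n (basisIndex n φ φ≤n) ⟧ᴬ ρ
    basis-sound n φ φ≤n = Eq.trans (normalise-sound n φ φ≤n)
      (Eq.reflexive (cong (λ x → ⟦ toFm (generators l n) x ⟧ᴬ ρ) (sym (decode-encode _))))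

compress : ∀ {κ K} → (Fin (suc κ) → Fin K) → Fin (suc K) → Fin K
compress f zero    = f zero
compress f (suc i) with any? (λ k → f k ≟ i)
... | yes _ = i
... | no  _ = f zero

compress-image⊆ : ∀ {κ K} (f : Fin (suc κ) → Fin K) k′ → ∃ λ k → compress f k′ ≡ f k
compress-image⊆ f zero    = zero , refl
compress-image⊆ f (suc i) with any? (λ k → f k ≟ i)
... | yes (k , fk≡i) = k , sym fk≡i
... | no  _          = zero , refl

compress-image⊇ : ∀ {κ K} (f : Fin (suc κ) → Fin K) k → ∃ λ k′ → compress f k′ ≡ f k
compress-image⊇ f k = suc (f k) , compress-at-fk
  where
    compress-at-fk : compress f (suc (f k)) ≡ f k
    compress-at-fk with any? (λ k′ → f k′ ≟ f k)
    ... | yes _ = refl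
    ... | no  ∄ = ⊥-elim (∄ (k , refl))

module NormalSystems (l d : ℕ) where

  K : ℕ
  K = basisSize (suc l) d

  systemCount : ℕ
  systemCount = K * K ^ suc K

  system : Fin systemCount → System l
  system R =
    let (t , s) = remQuot (K ^ suc K) R
    in record { t = basis (suc l) d t ; κ = K ; s = basis (suc l) d ∘ finToFun s }

  system-deg : ∀ R → SysDeg≤ (system R) d
  system-deg R = basis-deg (suc l) d _ , λ k → basis-deg (suc l) d _

  systemIndex : (S : System l) → SysDeg≤ S d → Fin systemCount
  systemIndex S (t≤d , s≤d) =
    combine (basisIndex d (System.t S) t≤d) (funToFin (compress (λ k → basisIndex d (System.s S k) (s≤d k))))

  system-t : ∀ (t : Fin K) (f : Fin (K ^ suc K)) → System.t (system (combine t f)) ≡ basis (suc l) d t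
  system-t t f = cong (basis (suc l) d ∘ proj₁) (remQuot-combine t f)

  system-s : ∀ (t : Fin K) (f : Fin (K ^ suc K)) k →
             System.s (system (combine t f)) k ≡ basis (suc l) d (finToFun f k)
  system-s t f k = cong (λ (_ , s) → basis (suc l) d (finToFun s k)) (remQuot-combine t f)

  module _ {c ℓ₁ ℓ₂} (A : HeytingAlgebra c ℓ₁ ℓ₂) where
    open HeytingAlgebra A using (Carrier; _≈_; module Eq)
    open BasisSemantics A using (basis-sound)

    private
      ⟦_⟧ᴬ : ∀ {k} → Fm k → Vector Carrier k → Carrier
      ⟦_⟧ᴬ = ⟦_⟧ A

    SolutionOf-transfer : (S S′ : System l) {a : Vector Carrier l} {q : Carrier} →
      ⟦ System.t S ⟧ᴬ (q ∷ a) ≈ ⟦ System.t S′ ⟧ᴬ (q ∷ a) →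
      (∀ k′ → ∃ λ k → ⟦ System.s S′ k′ ⟧ᴬ (q ∷ a) ≈ ⟦ System.s S k ⟧ᴬ (q ∷ a)) →
      SolutionOf A S a q → SolutionOf A S′ a q
    SolutionOf-transfer S S′ t≈t′ s′⊆s (t=⊤ , s≠⊤) =
      Eq.trans (Eq.sym t≈t′) t=⊤ ,
      λ k′ s′=⊤ → let (k , s′≈s) = s′⊆s k′ in s≠⊤ k (Eq.trans (Eq.sym s′≈s) s′=⊤)

    SolutionOf-systemIndex : ∀ S (S≤d : SysDeg≤ S d) {a q} →
      SolutionOf A S a q ⇔ SolutionOf A (system (systemIndex S S≤d)) a q
    SolutionOf-systemIndex S (t≤d , s≤d) {a} {q} =
      mk⇔ (SolutionOf-transfer S S′ t≈t′ s′⊆s) (SolutionOf-transfer S′ S (Eq.sym t≈t′) s⊆s′)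
      where
        ρ  = q ∷ a
        f  = λ k → basisIndex d (System.s S k) (s≤d k)
        t′ = basisIndex d (System.t S) t≤d
        S′ = system (combine t′ (funToFin (compress f)))

        ⟦s′⟧≡ : ∀ k′ k → compress f k′ ≡ f k → ⟦ System.s S′ k′ ⟧ᴬ ρ ≡ ⟦ basis (suc l) d (f k) ⟧ᴬ ρ
        ⟦s′⟧≡ k′ k cf≡f = cong (λ φ → ⟦ φ ⟧ᴬ ρ)
          (trans (system-s t′ _ k′) (cong (basis (suc l) d) (trans (finToFun-funToFin (compress f) k′) cf≡f)))

        t≈t′ : ⟦ System.t S ⟧ᴬ ρ ≈ ⟦ System.t S′ ⟧ᴬ ρ
        t≈t′ = Eq.trans (basis-sound ρ d (System.t S) t≤d)
                        (Eq.reflexive (cong (λ φ → ⟦ φ ⟧ᴬ ρ) (sym (system-t t′ _))))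

        s′⊆s : ∀ k′ → ∃ λ k → ⟦ System.s S′ k′ ⟧ᴬ ρ ≈ ⟦ System.s S k ⟧ᴬ ρ
        s′⊆s k′ = let (k , cf≡f) = compress-image⊆ f k′ in
          k , Eq.trans (Eq.reflexive (⟦s′⟧≡ k′ k cf≡f)) (Eq.sym (basis-sound ρ d (System.s S k) (s≤d k)))

        s⊆s′ : ∀ k → ∃ λ k′ → ⟦ System.s S k ⟧ᴬ ρ ≈ ⟦ System.s S′ k′ ⟧ᴬ ρ
        s⊆s′ k = let (k′ , cf≡f) = compress-image⊇ f k in
          k′ , Eq.trans (basis-sound ρ d (System.s S k) (s≤d k)) (Eq.reflexive (sym (⟦s′⟧≡ k′ k cf≡f)))

⋀ : ∀ {N k} → (Fin N → FO k) → FO k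
⋀ {zero}  φ = ⊤ᶠ
⋀ {suc N} φ = φ zero ∧ᶠ ⋀ (φ ∘ suc)

QuantifierFree-⋀ : ∀ {N k} (φ : Fin N → FO k) → (∀ i → QuantifierFree (φ i)) → QuantifierFree (⋀ φ)
QuantifierFree-⋀ {zero}  φ _    = top
QuantifierFree-⋀ {suc N} φ qf-φ = and (qf-φ zero) (QuantifierFree-⋀ (φ ∘ suc) (qf-φ ∘ suc))

∀ⁿ ∃ⁿ : ∀ m {k} → FO (m + k) → FO k
∀ⁿ zero    φ = φ
∀ⁿ (suc m) φ = ∀ⁿ m (∀ᶠ φ)
∃ⁿ zero    φ = φ
∃ⁿ (suc m) φ = ∃ⁿ m (∃ᶠ φ)

ForallExists-∀ⁿ : ∀ m {k} {φ : FO (m + k)} → ForallExists φ → ForallExists (∀ⁿ m φ)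
ForallExists-∀ⁿ zero    ∀∃φ = ∀∃φ
ForallExists-∀ⁿ (suc m) ∀∃φ = ForallExists-∀ⁿ m (al ∀∃φ)

Existential-∃ⁿ : ∀ m {k} {φ : FO (m + k)} → Existential φ → Existential (∃ⁿ m φ)
Existential-∃ⁿ zero    ∃φ = ∃φ
Existential-∃ⁿ (suc m) ∃φ = Existential-∃ⁿ m (ex ∃φ)

toTm : ∀ {j k} → Fm j → (Fin j → Fin k) → Tm k
toTm (var i)  σ = v (σ i)
toTm 𝟎        σ = 𝟎
toTm 𝟏        σ = 𝟏
toTm (φ ∧′ ψ) σ = toTm φ σ ∧ₜ toTm ψ σ
toTm (φ ∨′ ψ) σ = toTm φ σ ∨ₜ toTm ψ σ
toTm (φ ⇒′ ψ) σ = toTm φ σ ⇒ₜ toTm ψ σ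

isOne : ∀ {j k} → Fm j → (Fin j → Fin k) → FO k
isOne φ σ = toTm φ σ ≐ 𝟏

solutionFO : ∀ {l k} → System l → Fin k → (Fin l → Fin k) → FO k
solutionFO S q σ = isOne (System.t S) (q ∷ σ) ∧ᶠ ⋀ (λ i → isOne (System.s S i) (q ∷ σ) ⇒ᶠ ⊥ᶠ)

QuantifierFree-solutionFO : ∀ {l k} (S : System l) q (σ : Fin l → Fin k) → QuantifierFree (solutionFO S q σ)
QuantifierFree-solutionFO S q σ =
  and eq (QuantifierFree-⋀ (λ i → isOne (System.s S i) (q ∷ σ) ⇒ᶠ ⊥ᶠ) (λ _ → imp eq bot))

module _ {a} {C : Set a} where

  -- Unlike Data.Vec.Functional._++_, this recurses on the first vector, so that
  -- prepend (x ∷ xs) ρ reduces to x ∷ prepend xs ρ, matching one quantifier at a time.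
  prepend : ∀ {m k} → Vector C m → Vector C k → Vector C (m + k)
  prepend {zero}  xs ρ = ρ
  prepend {suc m} xs ρ = head xs ∷ prepend (tail xs) ρ

  prepend-↑ˡ : ∀ {m k} (xs : Vector C m) (ρ : Vector C k) i → prepend xs ρ (i ↑ˡ k) ≡ xs i
  prepend-↑ˡ xs ρ zero    = refl
  prepend-↑ˡ xs ρ (suc i) = prepend-↑ˡ (tail xs) ρ i

  prepend-↑ʳ : ∀ {m k} (xs : Vector C m) (ρ : Vector C k) j → prepend xs ρ (m ↑ʳ j) ≡ ρ j
  prepend-↑ʳ {zero}  xs ρ j = refl
  prepend-↑ʳ {suc m} xs ρ j = prepend-↑ʳ (tail xs) ρ j

module FOSemantics {c ℓ₁ ℓ₂} (A : HeytingAlgebra c ℓ₁ ℓ₂) where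
  open HeytingAlgebra A using (Carrier; _≈_; ⊤; _∧_; _∨_; _⇨_)
  open Equivalence using (to; from)

  private
    ⟦_⟧ᴬ : ∀ {k} → Fm k → Vector Carrier k → Carrier
    ⟦_⟧ᴬ = ⟦_⟧ A

  Sat-⋀ : ∀ {N k} (φ : Fin N → FO k) {ρ} → Sat A (⋀ φ) ρ ⇔ (∀ i → Sat A (φ i) ρ)
  Sat-⋀ {zero}  φ = mk⇔ (λ _ ()) (λ _ → lift _)
  Sat-⋀ {suc N} φ = mk⇔
    (λ { (φ₀ , φₛ) zero → φ₀ ; (φ₀ , φₛ) (suc i) → to (Sat-⋀ (φ ∘ suc)) φₛ i })
    (λ φᵢ → φᵢ zero , from (Sat-⋀ (φ ∘ suc)) (φᵢ ∘ suc))

  Sat-∀ⁿ : ∀ m {k} (φ : FO (m + k)) ρ → Sat A (∀ⁿ m φ) ρ ⇔ (∀ xs → Sat A φ (prepend xs ρ))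
  Sat-∀ⁿ zero    φ ρ = mk⇔ (λ sφ _ → sφ) (λ sφ → sφ (λ ()))
  Sat-∀ⁿ (suc m) φ ρ = mk⇔
    (λ s∀ xs → to (Sat-∀ⁿ m (∀ᶠ φ) ρ) s∀ (tail xs) (head xs))
    (λ s∀ → from (Sat-∀ⁿ m (∀ᶠ φ) ρ) (λ xs x → s∀ (x ∷ xs)))

  Sat-∃ⁿ : ∀ m {k} (φ : FO (m + k)) ρ → Sat A (∃ⁿ m φ) ρ ⇔ (∃ λ xs → Sat A φ (prepend xs ρ))
  Sat-∃ⁿ zero    φ ρ = mk⇔ (λ sφ → (λ ()) , sφ) proj₂
  Sat-∃ⁿ (suc m) φ ρ = mk⇔
    (λ s∃ → let (xs , (x , sφ)) = to (Sat-∃ⁿ m (∃ᶠ φ) ρ) s∃ in x ∷ xs , sφ)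
    (λ (xs , sφ) → from (Sat-∃ⁿ m (∃ᶠ φ) ρ) (tail xs , (head xs , sφ)))

  evalTm-toTm : ∀ {j k} (φ : Fm j) {σ : Fin j → Fin k} {ρ b} → (∀ i → ρ (σ i) ≡ b i) →
                evalTm A (toTm φ σ) ρ ≡ ⟦ φ ⟧ᴬ b
  evalTm-toTm (var i)  ρσ≡b = ρσ≡b i
  evalTm-toTm 𝟎        ρσ≡b = refl
  evalTm-toTm 𝟏        ρσ≡b = refl
  evalTm-toTm (φ ∧′ ψ) ρσ≡b = cong₂ _∧_ (evalTm-toTm φ ρσ≡b) (evalTm-toTm ψ ρσ≡b)
  evalTm-toTm (φ ∨′ ψ) ρσ≡b = cong₂ _∨_ (evalTm-toTm φ ρσ≡b) (evalTm-toTm ψ ρσ≡b)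
  evalTm-toTm (φ ⇒′ ψ) ρσ≡b = cong₂ _⇨_ (evalTm-toTm φ ρσ≡b) (evalTm-toTm ψ ρσ≡b)

  Sat-isOne : ∀ {j k} (φ : Fm j) {σ : Fin j → Fin k} {ρ b} → (∀ i → ρ (σ i) ≡ b i) →
    Sat A (isOne φ σ) ρ ⇔ (⟦ φ ⟧ᴬ b ≈ ⊤)
  Sat-isOne φ ρσ≡b =
    mk⇔ (λ (lift φ=⊤) → subst (_≈ ⊤) eval≡ φ=⊤) (λ φ=⊤ → lift (subst (_≈ ⊤) (sym eval≡) φ=⊤))
    where eval≡ = evalTm-toTm φ ρσ≡b

  Sat-solutionFO : ∀ {l k} (S : System l) {q : Fin k} {σ ρ a x} → ρ q ≡ x → (∀ i → ρ (σ i) ≡ a i) →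
    Sat A (solutionFO S q σ) ρ ⇔ SolutionOf A S a x
  Sat-solutionFO S {q} {σ} {ρ} {a} {x} ρq≡x ρσ≡a = mk⇔
    (λ (t=⊤ , s≠⊤) → to (t≈ (System.t S)) t=⊤ ,
       λ k s=⊤ → lower (to (Sat-⋀ negs) s≠⊤ k (from (t≈ (System.s S k)) s=⊤)))
    (λ (t=⊤ , s≠⊤) → from (t≈ (System.t S)) t=⊤ ,
       from (Sat-⋀ negs) (λ k s=⊤ → lift (s≠⊤ k (to (t≈ (System.s S k)) s=⊤))))
    where
      ρqσ≡xa : ∀ i → ρ ((q ∷ σ) i) ≡ (x ∷ a) i
      ρqσ≡xa zero    = ρq≡x
      ρqσ≡xa (suc i) = ρσ≡a i
      negs : Fin (suc (System.κ S)) → FO _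
      negs i = isOne (System.s S i) (q ∷ σ) ⇒ᶠ ⊥ᶠ
      t≈ : ∀ φ → Sat A (isOne φ (q ∷ σ)) ρ ⇔ (⟦ φ ⟧ᴬ (x ∷ a) ≈ ⊤)
      t≈ φ = Sat-isOne φ ρqσ≡xa

module _ {c ℓ₁ ℓ₂} (A : HeytingAlgebra c ℓ₁ ℓ₂) {l d : ℕ} where

  IndexProp-mono : ∀ {m n} → m ≤ n → IndexProp A l d m → IndexProp A l d n
  IndexProp-mono m≤n ip a a′ a≈a′ = ip a a′ (λ φ φ≤m → a≈a′ φ (≤-trans φ≤m m≤n))

  IndexLe⇔IndexProp : ∀ {n} → IndexLe A l d n ⇔ IndexProp A l d n
  IndexLe⇔IndexProp {n} = mk⇔ (λ (m , m≤n , ip) → IndexProp-mono m≤n ip) (λ ip → n , ≤-refl , ip)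

choose : ∀ {a p} {Z : Set a} {P : Z → Set p} → Z → Dec (∃ P) → ∃ λ z → ∃ P → P z
choose z₀ (yes (z , pz)) = z , λ _ → pz
choose z₀ (no ∄)         = z₀ , λ w → ⊥-elim (∄ w)

module IndexSentence (l d n : ℕ) where
  open NormalSystems l d

  N : ℕ
  N = systemCount

  -- The sentence is ∀ā ∀ā′ ∀q̄ ∃z̄ (ā, ā′ agree on the basis → ⋀_R (q_R solves system R at ā →
  -- z_R solves it at ā′)); its matrix lives in the context z̄, q̄, ā′, ā (innermost first).
  Ctx : ℕ
  Ctx = N + (N + (l + (l + 0)))

  zᵥ qᵥ : Fin N → Fin Ctx
  zᵥ R = R ↑ˡ _
  qᵥ R = N ↑ʳ (R ↑ˡ _)

  a′ᵥ aᵥ : Fin l → Fin Ctx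
  a′ᵥ i = N ↑ʳ (N ↑ʳ (i ↑ˡ _))
  aᵥ  i = N ↑ʳ (N ↑ʳ (l ↑ʳ (i ↑ˡ 0)))

  agreementAt : Fin (basisSize l n) → FO Ctx
  agreementAt i = (isOne φ aᵥ ⇒ᶠ isOne φ a′ᵥ) ∧ᶠ (isOne φ a′ᵥ ⇒ᶠ isOne φ aᵥ)
    where φ = basis l n i

  transferAt : Fin N → FO Ctx
  transferAt R = solutionFO (system R) (qᵥ R) aᵥ ⇒ᶠ solutionFO (system R) (zᵥ R) a′ᵥ

  sentence : Sentence
  sentence = ∀ⁿ l (∀ⁿ l (∀ⁿ N (∃ⁿ N (⋀ agreementAt ⇒ᶠ ⋀ transferAt))))

  sentence-∀∃ : ForallExists sentence
  sentence-∀∃ = ForallExists-∀ⁿ l (ForallExists-∀ⁿ l (ForallExists-∀ⁿ N (e (Existential-∃ⁿ N (qf (imp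
    (QuantifierFree-⋀ _ (λ _ → and (imp eq eq) (imp eq eq)))
    (QuantifierFree-⋀ _ (λ R → imp (QuantifierFree-solutionFO (system R) _ _)
                                   (QuantifierFree-solutionFO (system R) _ _)))))))))

  module _ {c ℓ₁ ℓ₂} (A : HeytingAlgebra c ℓ₁ ℓ₂) where
    open HeytingAlgebra A using (Carrier; _≈_; ⊤; module Eq)
    open BasisSemantics A using (basis-sound)
    open FOSemantics A
    open Equivalence using (to; from)

    private
      ⟦_⟧ᴬ : ∀ {k} → Fm k → Vector Carrier k → Carrier
      ⟦_⟧ᴬ = ⟦_⟧ A

    Agree : Vector Carrier l → Vector Carrier l → Set ℓ₁
    Agree a a′ = ∀ i → (⟦ basis l n i ⟧ᴬ a ≈ ⊤) ⇔ (⟦ basis l n i ⟧ᴬ a′ ≈ ⊤)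

    ≈[]⇔Agree : ∀ {a a′} → _≈[_]_ A a n a′ ⇔ Agree a a′
    ≈[]⇔Agree {a} {a′} = mk⇔ (λ a≈a′ i → a≈a′ (basis l n i) (basis-deg l n i)) λ agree φ φ≤n →
      ⇔.trans (=⊤-cong (basis-sound a n φ φ≤n))
              (⇔.trans (agree (basisIndex n φ φ≤n)) (⇔.sym (=⊤-cong (basis-sound a′ n φ φ≤n))))
      where
        =⊤-cong : ∀ {x y} → x ≈ y → (x ≈ ⊤) ⇔ (y ≈ ⊤)
        =⊤-cong x≈y = mk⇔ (Eq.trans (Eq.sym x≈y)) (Eq.trans x≈y)

    Transfer : Set (c ⊔ ℓ₁)
    Transfer = ∀ a a′ → Agree a a′ → ∀ R → Solvable A (system R) a → Solvable A (system R) a′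

    SkolemTransfer : Set (c ⊔ ℓ₁)
    SkolemTransfer = ∀ a a′ (qs : Vector Carrier N) → ∃ λ (zs : Vector Carrier N) →
      Agree a a′ → ∀ R → SolutionOf A (system R) a (qs R) → SolutionOf A (system R) a′ (zs R)

    IndexProp⇔Transfer : IndexProp A l d n ⇔ Transfer
    IndexProp⇔Transfer = mk⇔
      (λ ip a a′ agree R → to (ip a a′ (from ≈[]⇔Agree agree) (system R) (system-deg R)))
      (λ tr a a′ a≈a′ S S≤d → let agree = to ≈[]⇔Agree a≈a′ in
        mk⇔ (move tr S S≤d agree) (move tr S S≤d (⇔.sym ∘ agree)))
      where
        move : Transfer → ∀ S S≤d {a a′} → Agree a a′ → Solvable A S a → Solvable A S a′
        move tr S S≤d agree (q , sol) =
          let (z , sol′) = tr _ _ agree (systemIndex S S≤d) (q , to (SolutionOf-systemIndex A S S≤d) sol)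
          in z , from (SolutionOf-systemIndex A S S≤d) sol′

    -- Excluded middle decides which normal systems are solvable at ā′, so that the witnesses
    -- z_R can be fixed before the agreement hypothesis is known.
    Transfer⇔SkolemTransfer : ExcludedMiddle (c ⊔ ℓ₁) → Transfer ⇔ SkolemTransfer
    Transfer⇔SkolemTransfer em = mk⇔
      (λ tr a a′ qs → let witness R = choose ⊤ (em {Solvable A (system R) a′}) in
        proj₁ ∘ witness , λ agree R sol → proj₂ (witness R) (tr a a′ agree R (qs R , sol)))
      (λ sk a a′ agree R (q , sol) → let (zs , transfer) = sk a a′ (λ _ → q) in zs R , transfer agree R sol)

    Sat-matrix : ∀ {a a′ qs zs ρ₀} →
      Sat A (⋀ agreementAt ⇒ᶠ ⋀ transferAt) (prepend zs (prepend qs (prepend a′ (prepend a ρ₀)))) ⇔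
      (Agree a a′ → ∀ R → SolutionOf A (system R) a (qs R) → SolutionOf A (system R) a′ (zs R))
    Sat-matrix {a} {a′} {qs} {zs} {ρ₀} = mk⇔
      (λ m agree R sol → to (solZ R)
         (to (Sat-⋀ transferAt) (m (from sat-agree agree)) R (from (solQ R) sol)))
      (λ tr sagree → from (Sat-⋀ transferAt) λ R sq →
         from (solZ R) (tr (to sat-agree sagree) R (to (solQ R) sq)))
      where
        ρ = prepend zs (prepend qs (prepend a′ (prepend a ρ₀)))
        ρz : ∀ R → ρ (zᵥ R) ≡ zs R
        ρz R = prepend-↑ˡ zs _ R
        ρq : ∀ R → ρ (qᵥ R) ≡ qs R
        ρq R = trans (prepend-↑ʳ zs _ _) (prepend-↑ˡ qs _ R)
        ρa′ : ∀ i → ρ (a′ᵥ i) ≡ a′ i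
        ρa′ i = trans (prepend-↑ʳ zs _ _) (trans (prepend-↑ʳ qs _ _) (prepend-↑ˡ a′ _ i))
        ρa : ∀ i → ρ (aᵥ i) ≡ a i
        ρa i = trans (prepend-↑ʳ zs _ _)
                 (trans (prepend-↑ʳ qs _ _) (trans (prepend-↑ʳ a′ _ _) (prepend-↑ˡ a ρ₀ i)))
        solQ : ∀ R → Sat A (solutionFO (system R) (qᵥ R) aᵥ) ρ ⇔ SolutionOf A (system R) a (qs R)
        solZ : ∀ R → Sat A (solutionFO (system R) (zᵥ R) a′ᵥ) ρ ⇔ SolutionOf A (system R) a′ (zs R)
        solQ R = Sat-solutionFO (system R) (ρq R) ρa
        solZ R = Sat-solutionFO (system R) (ρz R) ρa′
        sat-agree : Sat A (⋀ agreementAt) ρ ⇔ Agree a a′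
        sat-agree = mk⇔
          (λ sa i → let (a⇒a′ , a′⇒a) = to (Sat-⋀ agreementAt) sa i in
             ⇔.trans (⇔.sym (at-a i)) (⇔.trans (mk⇔ a⇒a′ a′⇒a) (at-a′ i)))
          (λ agree → from (Sat-⋀ agreementAt) λ i →
             let a⇔a′ = ⇔.trans (at-a i) (⇔.trans (agree i) (⇔.sym (at-a′ i)))
             in to a⇔a′ , from a⇔a′)
          where
            at-a  : ∀ i → Sat A (isOne (basis l n i) aᵥ) ρ ⇔ (⟦ basis l n i ⟧ᴬ a ≈ ⊤)
            at-a′ : ∀ i → Sat A (isOne (basis l n i) a′ᵥ) ρ ⇔ (⟦ basis l n i ⟧ᴬ a′ ≈ ⊤)
            at-a  i = Sat-isOne (basis l n i) ρa
            at-a′ i = Sat-isOne (basis l n i) ρa′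

    ⊨sentence⇔SkolemTransfer : (A ⊨ sentence) ⇔ SkolemTransfer
    ⊨sentence⇔SkolemTransfer = mk⇔
      (λ ⊨s a a′ qs →
         let (zs , m) = to (Sat-∃ⁿ N _ _) (to (Sat-∀ⁿ N _ _)
                          (to (Sat-∀ⁿ l _ _) (to (Sat-∀ⁿ l _ _) ⊨s a) a′) qs)
         in zs , to Sat-matrix m)
      (λ sk → from (Sat-∀ⁿ l _ _) λ a → from (Sat-∀ⁿ l _ _) λ a′ →
         from (Sat-∀ⁿ N _ _) λ qs → from (Sat-∃ⁿ N _ _)
           (let (zs , tr) = sk a a′ qs in zs , from Sat-matrix tr))

    IndexLe⇔⊨sentence : ExcludedMiddle (c ⊔ ℓ₁) → IndexLe A l d n ⇔ (A ⊨ sentence)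
    IndexLe⇔⊨sentence em =
      ⇔.trans (IndexLe⇔IndexProp A)
      (⇔.trans IndexProp⇔Transfer
      (⇔.trans (Transfer⇔SkolemTransfer em) (⇔.sym ⊨sentence⇔SkolemTransfer)))

proposition4p5 : (l d n : ℕ) →
    ∃Sentenceω ForallExists
      (λ FC → ∀ {c ℓ₁ ℓ₂} (A : HeytingAlgebra c ℓ₁ ℓ₂) → ExcludedMiddle (c ⊔ ℓ₁) →
        (IndexLe A l d n ⇔ (A ⊨ FC)))
    ×ω
    (∀ {c ℓ₁ ℓ₂ c′ ℓ₁′ ℓ₂′} (A : HeytingAlgebra c ℓ₁ ℓ₂) (B : HeytingAlgebra c′ ℓ₁′ ℓ₂′) →
      ExcludedMiddle (c ⊔ ℓ₁) → ExcludedMiddle (c′ ⊔ ℓ₁′) →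
      ((σ : Sentence) → (A ⊨ σ) ⇔ (B ⊨ σ)) →
      (IndexLe A l d n ⇔ IndexLe B l d n))
proposition4p5 l d n = record { sentence = sentence ; prop₁ = sentence-∀∃ ; prop₂ = IndexLe⇔⊨sentence }
  , λ A B emA emB A≡B →
      ⇔.trans (IndexLe⇔⊨sentence A emA) (⇔.trans (A≡B sentence) (⇔.sym (IndexLe⇔⊨sentence B emB)))
  where open IndexSentence l d n
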